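{- Let $r$ be a complex number and $n\ge1$ an integer. Then $d_n^{(r)}(-\tfrac12)=0$ if $n$ is odd, and $d_n^{(r)}(-\tfrac12)=(-1)^{n/2}\binom{ -1/2-r}{n/2}$ if $n$ is even.
   Context: For a complex number $a$ and integer $k\ge0$, $\binom{a}{k}=a(a-1)\cdots(a-k+1)/k!$. For a parameter $r$ and an integer $n\ge 0$, $d_n^{(r)}(x)=\sum_{k=0}^n\binom{x+r+k}{k}\binom{x-r}{n-k}$. -}

module Defs where

open import Level using (Level; suc; _⊔_)
open import Data.Nat using (ℕ; zero; _∸_) renaming (suc to sucℕ)
open import Data.Fin using (Fin; toℕ)
import Algebra.Bundles
open import Algebra.Bundles using (CommutativeRing)
import Algebra.Definitions.RawSemiring as RS

-- The complex numbers are the instance of interest; the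
-- statement is formulated for every such ring.
record QAlgebra (c ℓ : Level) : Set (Level.suc (c ⊔ ℓ)) where
  field
    commRing : CommutativeRing c ℓ
  open CommutativeRing commRing public
  open RS (Algebra.Bundles.Semiring.rawSemiring semiring) public using (_×_; _^_; sum)
  field
    inv     : ℕ → Carrier
    inv-rig : ∀ n → (sucℕ n × 1#) * inv n ≈ 1#

module _ {c ℓ : Level} (A : QAlgebra c ℓ) where
  open QAlgebra A

  ι : ℕ → Carrier
  ι n = n × 1#

  half : Carrier
  half = inv 1

  falling : Carrier → ℕ → Carrier
  falling a zero     = 1#
  falling a (sucℕ k) = falling a k * (a - ι k)

  invFact : ℕ → Carrier
  invFact zero     = 1#
  invFact (sucℕ k) = invFact k * inv k

  binom : Carrier → ℕ → Carrier
  binom a k = falling a k * invFact k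

  d : ℕ → Carrier → Carrier → Carrier
  d n r x = sum {sucℕ n} (λ (k : Fin (sucℕ n)) →
              binom (x + r + ι (toℕ k)) (toℕ k) * binom (x - r) (n ∸ toℕ k))

{-# OPTIONS --safe #-}
module Submission where

-- At x = −½ the two factors of dₙ⁽ʳ⁾ become p k = binom (−½ + r + k) k = (−1)ᵏ binom b k and
-- q j = binom b j with b = −½ − r, i.e. the coefficients of (1 − t)ᵇ and (1 + t)ᵇ, so dₙ is the
-- n-th coefficient of (1 − t²)ᵇ.  This is proved without power series: the first-order
-- recurrences (k+1) pₖ₊₁ = (k − b) pₖ and (j+1) qⱼ₊₁ = (b − j) qⱼ make the convolution
-- satisfy (n+2) dₙ₊₂ = (n − 2b) dₙ with d₀ = 1 and d₁ = 0, and the claimed values satisfy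
-- the same recurrence; since n+2 is invertible, the recurrence determines the sequence.

open import Defs
open import Level using (Level)
open import Data.Nat as ℕ using (ℕ; zero; suc; _∸_)
import Data.Nat.Properties as ℕₚ
open import Data.Fin using (toℕ)
open import Data.Maybe using (Maybe; just; nothing)
open import Data.Product using (_×_; _,_; proj₁; proj₂)
open import Relation.Binary.PropositionalEquality as ≡ using (_≡_)
open import Relation.Nullary using (yes; no)
open import Algebra.Bundles using (RawRing; Semiring; CommutativeRing)
open import Algebra.Solver.Ring.AlmostCommutativeRing
  using (fromCommutativeRing; _-Raw-AlmostCommutative⟶_)
import Algebra.Definitions.RawSemiring
import Algebra.Properties.CommutativeSemigroup
import Algebra.Properties.Ring
import Algebra.Properties.Semiring.Mult
import Algebra.Solver.Ring
import Relation.Binary.Reasoning.Setoid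

-- The pair (a , b) stands for the integer a − b; cancelCommon picks a canonical
-- representative, which the solver needs since it compares normal forms by refl.
cancelCommon : ℕ × ℕ → ℕ × ℕ
cancelCommon (suc a , suc b) = cancelCommon (a , b)
cancelCommon ab              = ab

cancelCommon-sound : ∀ a b → proj₁ (cancelCommon (a , b)) ℕ.+ b ≡ a ℕ.+ proj₂ (cancelCommon (a , b))
cancelCommon-sound zero    b       = ≡.refl
cancelCommon-sound (suc a) zero    = ≡.refl
cancelCommon-sound (suc a) (suc b) = ≡.trans (ℕₚ.+-suc _ b) (≡.cong suc (cancelCommon-sound a b))

differenceRawRing : RawRing _ _
differenceRawRing = record
  { Carrier = ℕ × ℕ
  ; _≈_     = _≡_
  ; _+_     = λ { (a , b) (c , d) → cancelCommon (a ℕ.+ c , b ℕ.+ d) }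
  ; _*_     = λ { (a , b) (c , d) → cancelCommon (a ℕ.* c ℕ.+ b ℕ.* d , a ℕ.* d ℕ.+ b ℕ.* c) }
  ; -_      = λ { (a , b) → (b , a) }
  ; 0#      = (0 , 0)
  ; 1#      = (1 , 0)
  }

module IntegerCoefficientSolver {c ℓ} (R : CommutativeRing c ℓ) where
  open CommutativeRing R
  open Algebra.Properties.Ring ring using ([y-z]x≈yx-zx; x[y-z]≈xy-xz; ⁻¹-anti-homo‿-; -‿+-comm; -0#≈0#)
  open Algebra.Properties.CommutativeSemigroup +-commutativeSemigroup using (interchange)
  open Algebra.Properties.Semiring.Mult semiring using (×-homo-+; ×1-homo-*) renaming (_×_ to _·_)
  open Relation.Binary.Reasoning.Setoid setoid

  -- Written out as 1# + ⋯ + 1# so that the constants con (1 , 0), con (0 , 1), con (2 , 0), …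
  -- of a solved equation are literally 1#, - 1#, 1# + 1#, …
  numeral : ℕ → Carrier
  numeral 0                   = 0#
  numeral 1                   = 1#
  numeral (suc (suc n))       = 1# + numeral (suc n)

  numeral≈·1# : ∀ n → numeral n ≈ n · 1#
  numeral≈·1# 0             = refl
  numeral≈·1# 1             = sym (+-identityʳ 1#)
  numeral≈·1# (suc (suc n)) = +-congˡ (numeral≈·1# (suc n))

  ⟦_⟧ : ℕ × ℕ → Carrier
  ⟦ a     , 0     ⟧ = numeral a
  ⟦ 0     , suc b ⟧ = - numeral (suc b)
  ⟦ suc a , suc b ⟧ = numeral (suc a) - numeral (suc b)

  [x-y]+[z-w]≈[x+z]-[y+w] : ∀ x y z w → (x - y) + (z - w) ≈ (x + z) - (y + w)
  [x-y]+[z-w]≈[x+z]-[y+w] x y z w = trans (interchange x (- y) z (- w)) (+-congˡ (-‿+-comm y w))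

  [x-y]*[z-w]≈[xz+yw]-[xw+yz] : ∀ x y z w → (x - y) * (z - w) ≈ (x * z + y * w) - (x * w + y * z)
  [x-y]*[z-w]≈[xz+yw]-[xw+yz] x y z w = begin
    (x - y) * (z - w)                     ≈⟨ [y-z]x≈yx-zx (z - w) x y ⟩
    x * (z - w) - y * (z - w)             ≈⟨ +-cong (x[y-z]≈xy-xz x z w) (-‿cong (x[y-z]≈xy-xz y z w)) ⟩
    (x * z - x * w) + - (y * z - y * w)   ≈⟨ +-congˡ (⁻¹-anti-homo‿- (y * z) (y * w)) ⟩
    (x * z - x * w) + (y * w - y * z)     ≈⟨ [x-y]+[z-w]≈[x+z]-[y+w] (x * z) (x * w) (y * w) (y * z) ⟩
    (x * z + y * w) - (x * w + y * z)     ∎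

  x+w≈z+y⇒x-y≈z-w : ∀ x y z w → x + w ≈ z + y → x - y ≈ z - w
  x+w≈z+y⇒x-y≈z-w x y z w e = begin
    x - y                  ≈⟨ +-identityʳ (x - y) ⟨
    (x - y) + 0#           ≈⟨ +-congˡ (-‿inverseʳ w) ⟨
    (x - y) + (w - w)      ≈⟨ [x-y]+[z-w]≈[x+z]-[y+w] x y w w ⟩
    (x + w) - (y + w)      ≈⟨ +-cong e (-‿cong (+-comm y w)) ⟩
    (z + y) - (w + y)      ≈⟨ [x-y]+[z-w]≈[x+z]-[y+w] z w y y ⟨
    (z - w) + (y - y)      ≈⟨ +-congˡ (-‿inverseʳ y) ⟩
    (z - w) + 0#           ≈⟨ +-identityʳ (z - w) ⟩
    z - w                  ∎

  ⟦⟧≈difference : ∀ a b → ⟦ a , b ⟧ ≈ a · 1# - b · 1#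
  ⟦⟧≈difference a       0       = trans (numeral≈·1# a) (trans (sym (+-identityʳ _)) (+-congˡ (sym -0#≈0#)))
  ⟦⟧≈difference 0       (suc b) = trans (sym (+-identityˡ _)) (+-congˡ (-‿cong (numeral≈·1# (suc b))))
  ⟦⟧≈difference (suc a) (suc b) = +-cong (numeral≈·1# (suc a)) (-‿cong (numeral≈·1# (suc b)))

  difference-cong : ∀ a b c d → a ℕ.+ d ≡ c ℕ.+ b → a · 1# - b · 1# ≈ c · 1# - d · 1#
  difference-cong a b c d e = x+w≈z+y⇒x-y≈z-w _ _ _ _ (begin
    a · 1# + d · 1#   ≈⟨ ×-homo-+ 1# a d ⟨
    (a ℕ.+ d) · 1#    ≡⟨ ≡.cong (_· 1#) e ⟩
    (c ℕ.+ b) · 1#    ≈⟨ ×-homo-+ 1# c b ⟩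
    c · 1# + b · 1#   ∎)

  ⟦cancelCommon⟧ : ∀ a b → ⟦ cancelCommon (a , b) ⟧ ≈ a · 1# - b · 1#
  ⟦cancelCommon⟧ a b = trans (⟦⟧≈difference a′ b′) (difference-cong a′ b′ a b (cancelCommon-sound a b))
    where
    a′ b′ : ℕ
    a′ = proj₁ (cancelCommon (a , b))
    b′ = proj₂ (cancelCommon (a , b))

  homomorphism : differenceRawRing -Raw-AlmostCommutative⟶ fromCommutativeRing R
  homomorphism = record
    { ⟦_⟧    = ⟦_⟧
    ; +-homo = +-homo
    ; *-homo = *-homo
    ; -‿homo = λ { (a , b) → trans (⟦⟧≈difference b a)
                    (trans (sym (⁻¹-anti-homo‿- (a · 1#) (b · 1#))) (-‿cong (sym (⟦⟧≈difference a b)))) }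
    ; 0-homo = refl
    ; 1-homo = refl
    }
    where
    +-homo : ∀ x y → ⟦ cancelCommon (proj₁ x ℕ.+ proj₁ y , proj₂ x ℕ.+ proj₂ y) ⟧ ≈ ⟦ x ⟧ + ⟦ y ⟧
    +-homo (a , b) (c , d) = begin
      ⟦ cancelCommon (a ℕ.+ c , b ℕ.+ d) ⟧  ≈⟨ ⟦cancelCommon⟧ (a ℕ.+ c) (b ℕ.+ d) ⟩
      (a ℕ.+ c) · 1# - (b ℕ.+ d) · 1#     ≈⟨ +-cong (×-homo-+ 1# a c) (-‿cong (×-homo-+ 1# b d)) ⟩
      (a · 1# + c · 1#) - (b · 1# + d · 1#) ≈⟨ [x-y]+[z-w]≈[x+z]-[y+w] _ _ _ _ ⟨
      (a · 1# - b · 1#) + (c · 1# - d · 1#) ≈⟨ +-cong (⟦⟧≈difference a b) (⟦⟧≈difference c d) ⟨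
      ⟦ a , b ⟧ + ⟦ c , d ⟧                ∎
    *-homo : ∀ x y → ⟦ RawRing._*_ differenceRawRing x y ⟧ ≈ ⟦ x ⟧ * ⟦ y ⟧
    *-homo (a , b) (c , d) = begin
      ⟦ cancelCommon (a ℕ.* c ℕ.+ b ℕ.* d , a ℕ.* d ℕ.+ b ℕ.* c) ⟧
        ≈⟨ ⟦cancelCommon⟧ (a ℕ.* c ℕ.+ b ℕ.* d) (a ℕ.* d ℕ.+ b ℕ.* c) ⟩
      (a ℕ.* c ℕ.+ b ℕ.* d) · 1# - (a ℕ.* d ℕ.+ b ℕ.* c) · 1#
        ≈⟨ +-cong (trans (×-homo-+ 1# (a ℕ.* c) (b ℕ.* d)) (+-cong (×1-homo-* a c) (×1-homo-* b d)))
                  (-‿cong (trans (×-homo-+ 1# (a ℕ.* d) (b ℕ.* c)) (+-cong (×1-homo-* a d) (×1-homo-* b c)))) ⟩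
      (a · 1# * c · 1# + b · 1# * d · 1#) - (a · 1# * d · 1# + b · 1# * c · 1#)
        ≈⟨ [x-y]*[z-w]≈[xz+yw]-[xw+yz] _ _ _ _ ⟨
      (a · 1# - b · 1#) * (c · 1# - d · 1#)
        ≈⟨ *-cong (⟦⟧≈difference a b) (⟦⟧≈difference c d) ⟨
      ⟦ a , b ⟧ * ⟦ c , d ⟧ ∎

  coefficient≟ : ∀ x y → Maybe (⟦ x ⟧ ≈ ⟦ y ⟧)
  coefficient≟ (a , b) (c , d) with a ℕ.+ d ℕₚ.≟ c ℕ.+ b
  ... | yes e = just (trans (⟦⟧≈difference a b) (trans (difference-cong a b c d e) (sym (⟦⟧≈difference c d))))
  ... | no _  = nothing

  open Algebra.Solver.Ring differenceRawRing (fromCommutativeRing R) homomorphism coefficient≟ public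
    using (solve; _:=_; _:+_; _:*_; _:-_; :-_; con)

module Antidiagonal {c ℓ} (S : Semiring c ℓ) where
  open Semiring S
  open Algebra.Definitions.RawSemiring rawSemiring using (sum)
  open Algebra.Properties.CommutativeSemigroup +-commutativeSemigroup using (interchange)
  open Relation.Binary.Reasoning.Setoid setoid

  antidiagonal : ℕ → (ℕ → ℕ → Carrier) → Carrier
  antidiagonal zero    h = h 0 0
  antidiagonal (suc n) h = h 0 (suc n) + antidiagonal n (λ k j → h (suc k) j)

  antidiagonal-cong : ∀ n {h g : ℕ → ℕ → Carrier} → (∀ k j → h k j ≈ g k j) →
                      antidiagonal n h ≈ antidiagonal n g
  antidiagonal-cong zero    e = e 0 0
  antidiagonal-cong (suc n) e = +-cong (e 0 (suc n)) (antidiagonal-cong n (λ k → e (suc k)))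

  antidiagonal-+ : ∀ n (h g : ℕ → ℕ → Carrier) →
                   antidiagonal n (λ k j → h k j + g k j) ≈ antidiagonal n h + antidiagonal n g
  antidiagonal-+ zero    h g = refl
  antidiagonal-+ (suc n) h g =
    trans (+-congˡ (antidiagonal-+ n _ _)) (interchange _ _ _ _)

  antidiagonal-*ˡ : ∀ n x (h : ℕ → ℕ → Carrier) →
                    antidiagonal n (λ k j → x * h k j) ≈ x * antidiagonal n h
  antidiagonal-*ˡ zero    x h = refl
  antidiagonal-*ˡ (suc n) x h = trans (+-congˡ (antidiagonal-*ˡ n x _)) (sym (distribˡ x _ _))

  antidiagonal-*ˡ-index : ∀ n (f : ℕ → Carrier) (h : ℕ → ℕ → Carrier) →
                          antidiagonal n (λ k j → f (k ℕ.+ j) * h k j) ≈ f n * antidiagonal n h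
  antidiagonal-*ˡ-index zero    f h = refl
  antidiagonal-*ˡ-index (suc n) f h =
    trans (+-congˡ (antidiagonal-*ˡ-index n (λ i → f (suc i)) _)) (sym (distribˡ _ _ _))

  antidiagonal-sucʳ : ∀ n (h : ℕ → ℕ → Carrier) →
                      antidiagonal (suc n) h ≈ antidiagonal n (λ k j → h k (suc j)) + h (suc n) 0
  antidiagonal-sucʳ zero    h = refl
  antidiagonal-sucʳ (suc n) h =
    trans (+-congˡ (antidiagonal-sucʳ n (λ k → h (suc k)))) (sym (+-assoc _ _ _))

  sum-convolution≈antidiagonal : ∀ n (f g : ℕ → Carrier) →
    sum {suc n} (λ k → f (toℕ k) * g (n ∸ toℕ k)) ≈ antidiagonal n (λ k j → f k * g j)
  sum-convolution≈antidiagonal zero    f g = +-identityʳ _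
  sum-convolution≈antidiagonal (suc n) f g = +-congˡ (sum-convolution≈antidiagonal n (λ k → f (suc k)) g)

module Convolution {c ℓ} (R : CommutativeRing c ℓ) where
  open CommutativeRing R
  open Algebra.Definitions.RawSemiring (Semiring.rawSemiring semiring) using () renaming (_×_ to _·_)
  open Algebra.Properties.Semiring.Mult semiring using (×-homo-+)
  open Relation.Binary.Reasoning.Setoid setoid
  open IntegerCoefficientSolver R using (solve; _:=_; _:+_; _:*_; _:-_; :-_; con)
  open Antidiagonal semiring

  module FirstOrder (b : Carrier) (p q : ℕ → Carrier) (p₀≈1 : p 0 ≈ 1#) (q₀≈1 : q 0 ≈ 1#)
    (p-step : ∀ k → suc k · 1# * p (suc k) ≈ (k · 1# - b) * p k)
    (q-step : ∀ j → suc j · 1# * q (suc j) ≈ (b - j · 1#) * q j)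
    where

    convolution : ℕ → Carrier
    convolution n = antidiagonal n (λ k j → p k * q j)

    convolution-0 : convolution 0 ≈ 1#
    convolution-0 = trans (*-cong p₀≈1 q₀≈1) (*-identityˡ 1#)

    convolution-1 : convolution 1 ≈ 0#
    convolution-1 = begin
      p 0 * q 1 + p 1 * q 0          ≈⟨ +-cong (*-cong p₀≈1 q₁≈b) (*-cong p₁≈-b q₀≈1) ⟩
      1# * (b - 0#) + (0# - b) * 1#
        ≈⟨ solve 1 (λ b → con (1 , 0) :* (b :- con (0 , 0)) :+ (con (0 , 0) :- b) :* con (1 , 0)
                          := con (0 , 0)) refl b ⟩
      0#                             ∎
      where
      1·1#*x≈x : ∀ x → 1 · 1# * x ≈ x
      1·1#*x≈x x = trans (*-congʳ (+-identityʳ 1#)) (*-identityˡ x)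
      p₁≈-b : p 1 ≈ 0# - b
      p₁≈-b = trans (sym (1·1#*x≈x (p 1))) (trans (p-step 0) (trans (*-congˡ p₀≈1) (*-identityʳ _)))
      q₁≈b : q 1 ≈ b - 0#
      q₁≈b = trans (sym (1·1#*x≈x (q 1))) (trans (q-step 0) (trans (*-congˡ q₀≈1) (*-identityʳ _)))

    private
      weightedˡ weightedʳ : ℕ → Carrier
      weightedˡ n = antidiagonal n (λ k j → k · 1# * (p k * q j))
      weightedʳ n = antidiagonal n (λ k j → j · 1# * (p k * q j))

      n*convolution≈weighted : ∀ n → n · 1# * convolution n ≈ weightedˡ n + weightedʳ n
      n*convolution≈weighted n = begin
        n · 1# * convolution n
          ≈⟨ antidiagonal-*ˡ-index n (_· 1#) _ ⟨
        antidiagonal n (λ k j → (k ℕ.+ j) · 1# * (p k * q j))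
          ≈⟨ antidiagonal-cong n (λ k j → trans (*-congʳ (×-homo-+ 1# k j)) (distribʳ _ _ _)) ⟩
        antidiagonal n (λ k j → k · 1# * (p k * q j) + j · 1# * (p k * q j))
          ≈⟨ antidiagonal-+ n _ _ ⟩
        weightedˡ n + weightedʳ n ∎

      weightedˡ-suc : ∀ n → weightedˡ (suc n) ≈ weightedˡ n + (- b) * convolution n
      weightedˡ-suc n = begin
        weightedˡ (suc n)
          ≈⟨ +-cong (zeroˡ _) (antidiagonal-cong n shift) ⟩
        0# + antidiagonal n (λ k j → k · 1# * (p k * q j) + (- b) * (p k * q j))
          ≈⟨ +-identityˡ _ ⟩
        antidiagonal n (λ k j → k · 1# * (p k * q j) + (- b) * (p k * q j))
          ≈⟨ trans (antidiagonal-+ n _ _) (+-congˡ (antidiagonal-*ˡ n (- b) _)) ⟩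
        weightedˡ n + (- b) * convolution n ∎
        where
        shift : ∀ k j → suc k · 1# * (p (suc k) * q j) ≈ k · 1# * (p k * q j) + (- b) * (p k * q j)
        shift k j = trans (sym (*-assoc _ _ _)) (trans (*-congʳ (p-step k))
          (solve 4 (λ u b P Q → ((u :- b) :* P) :* Q := u :* (P :* Q) :+ (:- b) :* (P :* Q))
                 refl (k · 1#) b (p k) (q j)))

      weightedʳ-suc : ∀ n → weightedʳ (suc n) ≈ b * convolution n + (- 1#) * weightedʳ n
      weightedʳ-suc n = begin
        weightedʳ (suc n)
          ≈⟨ antidiagonal-sucʳ n (λ k j → j · 1# * (p k * q j)) ⟩
        antidiagonal n (λ k j → suc j · 1# * (p k * q (suc j))) + 0# * (p (suc n) * q 0)
          ≈⟨ +-cong (antidiagonal-cong n shift) (zeroˡ _) ⟩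
        antidiagonal n (λ k j → b * (p k * q j) + (- 1#) * (j · 1# * (p k * q j))) + 0#
          ≈⟨ +-identityʳ _ ⟩
        antidiagonal n (λ k j → b * (p k * q j) + (- 1#) * (j · 1# * (p k * q j)))
          ≈⟨ trans (antidiagonal-+ n _ _) (+-cong (antidiagonal-*ˡ n b _) (antidiagonal-*ˡ n (- 1#) _)) ⟩
        b * convolution n + (- 1#) * weightedʳ n ∎
        where
        shift : ∀ k j → suc j · 1# * (p k * q (suc j)) ≈ b * (p k * q j) + (- 1#) * (j · 1# * (p k * q j))
        shift k j = trans (solve 3 (λ i P Q → i :* (P :* Q) := P :* (i :* Q)) refl (suc j · 1#) (p k) (q (suc j)))
          (trans (*-congˡ (q-step j))
          (solve 4 (λ u b P Q → P :* ((b :- u) :* Q) := b :* (P :* Q) :+ con (0 , 1) :* (u :* (P :* Q)))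
                 refl (j · 1#) b (p k) (q j)))

    -- Splitting (n+2)·sₙ₊₂ by the weights k and j, the −b·sₙ₊₁ and +b·sₙ₊₁ produced by the
    -- recurrences of p and of q cancel.
    convolution-step : ∀ n → suc (suc n) · 1# * convolution (suc (suc n)) ≈ (n · 1# - (b + b)) * convolution n
    convolution-step n = begin
      suc (suc n) · 1# * convolution (suc (suc n))
        ≈⟨ n*convolution≈weighted (suc (suc n)) ⟩
      weightedˡ (suc (suc n)) + weightedʳ (suc (suc n))
        ≈⟨ +-cong (trans (weightedˡ-suc (suc n)) (+-congʳ (weightedˡ-suc n)))
                  (trans (weightedʳ-suc (suc n)) (+-congˡ (*-congˡ (weightedʳ-suc n)))) ⟩
      ((L + (- b) * s₀) + (- b) * s₁) + (b * s₁ + (- 1#) * (b * s₀ + (- 1#) * R′))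
        ≈⟨ solve 5 (λ L R′ s₀ s₁ b →
                      ((L :+ (:- b) :* s₀) :+ (:- b) :* s₁) :+ (b :* s₁ :+ con (0 , 1) :* (b :* s₀ :+ con (0 , 1) :* R′))
                      := (L :+ R′) :- (b :+ b) :* s₀)
                 refl L R′ s₀ s₁ b ⟩
      (L + R′) - (b + b) * s₀
        ≈⟨ +-congʳ (n*convolution≈weighted n) ⟨
      n · 1# * s₀ - (b + b) * s₀
        ≈⟨ solve 3 (λ u s b → u :* s :- (b :+ b) :* s := (u :- (b :+ b)) :* s) refl (n · 1#) s₀ b ⟩
      (n · 1# - (b + b)) * convolution n ∎
      where
      L R′ s₀ s₁ : Carrier
      L  = weightedˡ n
      R′ = weightedʳ n
      s₀ = convolution n
      s₁ = convolution (suc n)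

module _ {c ℓ} (A : QAlgebra c ℓ) where
  open QAlgebra A hiding (_×_)
  open IntegerCoefficientSolver commRing using (solve; _:=_; _:+_; _:*_; _:-_; :-_; con)
  open Algebra.Properties.Semiring.Mult semiring using (×1-homo-*)
  open Relation.Binary.Reasoning.Setoid setoid

  ι-suc-cancelˡ : ∀ n {x y} → ι A (suc n) * x ≈ ι A (suc n) * y → x ≈ y
  ι-suc-cancelˡ n {x} {y} e = trans (sym (inv*ι*z≈z x)) (trans (*-congˡ e) (inv*ι*z≈z y))
    where
    inv*ι*z≈z : ∀ z → inv n * (ι A (suc n) * z) ≈ z
    inv*ι*z≈z z = begin
      inv n * (ι A (suc n) * z)   ≈⟨ *-assoc _ _ _ ⟨
      (inv n * ι A (suc n)) * z   ≈⟨ *-congʳ (trans (*-comm _ _) (inv-rig n)) ⟩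
      1# * z                      ≈⟨ *-identityˡ z ⟩
      z                           ∎

  module TwoStepRecurrence (f s : ℕ → Carrier)
    (s-step : ∀ n → ι A (suc (suc n)) * s (suc (suc n)) ≈ f n * s n) where

    vanishes-at-odd : s 1 ≈ 0# → ∀ m → s (2 ℕ.* m ℕ.+ 1) ≈ 0#
    vanishes-at-odd s₁≈0 zero    = s₁≈0
    vanishes-at-odd s₁≈0 (suc m) =
      trans (reflexive (≡.cong (λ i → s (i ℕ.+ 1)) (ℕₚ.*-suc 2 m))) (ι-suc-cancelˡ (suc n) (begin
        ι A (suc (suc n)) * s (suc (suc n))  ≈⟨ s-step n ⟩
        f n * s n                            ≈⟨ *-congˡ (vanishes-at-odd s₁≈0 m) ⟩
        f n * 0#                             ≈⟨ zeroʳ _ ⟩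
        0#                                   ≈⟨ zeroʳ _ ⟨
        ι A (suc (suc n)) * 0#               ∎))
      where
      n : ℕ
      n = 2 ℕ.* m ℕ.+ 1

    unique-at-even : (t : ℕ → Carrier) → s 0 ≈ t 0 →
                     (∀ m → ι A (suc (suc (2 ℕ.* m))) * t (suc m) ≈ f (2 ℕ.* m) * t m) →
                     ∀ m → s (2 ℕ.* m) ≈ t m
    unique-at-even t s₀≈t₀ t-step zero    = s₀≈t₀
    unique-at-even t s₀≈t₀ t-step (suc m) =
      trans (reflexive (≡.cong s (ℕₚ.*-suc 2 m))) (ι-suc-cancelˡ (suc n) (begin
        ι A (suc (suc n)) * s (suc (suc n))  ≈⟨ s-step n ⟩
        f n * s n                            ≈⟨ *-congˡ (unique-at-even t s₀≈t₀ t-step m) ⟩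
        f n * t m                            ≈⟨ t-step m ⟨
        ι A (suc (suc n)) * t (suc m)        ∎))
      where
      n : ℕ
      n = 2 ℕ.* m

  falling-cong : ∀ k {a a′} → a ≈ a′ → falling A a k ≈ falling A a′ k
  falling-cong zero    e = refl
  falling-cong (suc k) e = *-cong (falling-cong k e) (+-congʳ e)

  falling-suc≈*falling-pred : ∀ a k → falling A a (suc k) ≈ a * falling A (a - 1#) k
  falling-suc≈*falling-pred a zero    =
    solve 1 (λ a → con (1 , 0) :* (a :- con (0 , 0)) := a :* con (1 , 0)) refl a
  falling-suc≈*falling-pred a (suc k) =
    trans (*-congʳ (falling-suc≈*falling-pred a k))
      (solve 3 (λ a F u → (a :* F) :* (a :- (con (1 , 0) :+ u)) := a :* (F :* ((a :- con (1 , 0)) :- u)))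
             refl a (falling A (a - 1#) k) (ι A k))

  ι*binom-suc : ∀ a k → ι A (suc k) * binom A a (suc k) ≈ falling A a (suc k) * invFact A k
  ι*binom-suc a k = begin
    ι A (suc k) * (F * (I * inv k))   ≈⟨ solve 4 (λ i F I v → i :* (F :* (I :* v)) := (F :* I) :* (i :* v))
                                                  refl (ι A (suc k)) F I (inv k) ⟩
    (F * I) * (ι A (suc k) * inv k)   ≈⟨ *-congˡ (inv-rig k) ⟩
    (F * I) * 1#                      ≈⟨ *-identityʳ _ ⟩
    F * I                             ∎
    where
    F I : Carrier
    F = falling A a (suc k)
    I = invFact A k

  binom-step : ∀ a k → ι A (suc k) * binom A a (suc k) ≈ (a - ι A k) * binom A a k
  binom-step a k = trans (ι*binom-suc a k)
    (solve 3 (λ F u I → (F :* u) :* I := u :* (F :* I)) refl (falling A a k) (a - ι A k) (invFact A k))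

  binom-diagonal-step : ∀ e k → ι A (suc k) * binom A (e + ι A (suc k)) (suc k)
                                ≈ (e + ι A (suc k)) * binom A (e + ι A k) k
  binom-diagonal-step e k = begin
    ι A (suc k) * binom A (e + ι A (suc k)) (suc k)
      ≈⟨ ι*binom-suc (e + ι A (suc k)) k ⟩
    falling A (e + ι A (suc k)) (suc k) * invFact A k
      ≈⟨ *-congʳ (falling-suc≈*falling-pred (e + ι A (suc k)) k) ⟩
    ((e + ι A (suc k)) * falling A (e + ι A (suc k) - 1#) k) * invFact A k
      ≈⟨ *-congʳ (*-congˡ (falling-cong k
           (solve 2 (λ e u → (e :+ (con (1 , 0) :+ u)) :- con (1 , 0) := e :+ u) refl e (ι A k)))) ⟩
    ((e + ι A (suc k)) * falling A (e + ι A k) k) * invFact A k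
      ≈⟨ *-assoc _ _ _ ⟩
    (e + ι A (suc k)) * binom A (e + ι A k) k ∎

  signed-binom-step : ∀ b m →
    ι A (suc (suc (2 ℕ.* m))) * ((- 1#) ^ suc m * binom A b (suc m))
      ≈ (ι A (2 ℕ.* m) - (b + b)) * ((- 1#) ^ m * binom A b m)
  signed-binom-step b m = begin
    (1# + (1# + ι A (2 ℕ.* m))) * ((- 1# * E) * B₁)
      ≈⟨ *-congʳ (+-congˡ (+-congˡ (×1-homo-* 2 m))) ⟩
    (1# + (1# + (1# + (1# + 0#)) * u)) * ((- 1# * E) * B₁)
      ≈⟨ solve 3 (λ u E B₁ → (con (1 , 0) :+ (con (1 , 0) :+ (con (1 , 0) :+ (con (1 , 0) :+ con (0 , 0))) :* u))
                              :* ((con (0 , 1) :* E) :* B₁)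
                             := (con (0 , 2) :* E) :* ((con (1 , 0) :+ u) :* B₁)) refl u E B₁ ⟩
    (- (1# + 1#) * E) * (ι A (suc m) * B₁)
      ≈⟨ *-congˡ (binom-step b m) ⟩
    (- (1# + 1#) * E) * ((b - u) * B₀)
      ≈⟨ solve 4 (λ u E B₀ b → (con (0 , 2) :* E) :* ((b :- u) :* B₀)
                             := ((con (1 , 0) :+ (con (1 , 0) :+ con (0 , 0))) :* u :- (b :+ b)) :* (E :* B₀))
                 refl u E B₀ b ⟩
    ((1# + (1# + 0#)) * u - (b + b)) * (E * B₀)
      ≈⟨ *-congʳ (+-congʳ (×1-homo-* 2 m)) ⟨
    (ι A (2 ℕ.* m) - (b + b)) * (E * B₀) ∎
    where
    u E B₀ B₁ : Carrier
    u  = ι A m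
    E  = (- 1#) ^ m
    B₀ = binom A b m
    B₁ = binom A b (suc m)

  half+half≈1 : half A + half A ≈ 1#
  half+half≈1 = trans
    (solve 1 (λ h → h :+ h := (con (1 , 0) :+ (con (1 , 0) :+ con (0 , 0))) :* h) refl (half A))
    (inv-rig 1)

  [−½+r]+[1+k]≈k-[−½-r] : ∀ r k → (- half A + r) + ι A (suc k) ≈ ι A k - (- half A - r)
  [−½+r]+[1+k]≈k-[−½-r] r k = begin
    (- half A + r) + (1# + ι A k)                 ≈⟨ +-congˡ (+-congʳ half+half≈1) ⟨
    (- half A + r) + ((half A + half A) + ι A k)
      ≈⟨ solve 3 (λ h r u → (:- h :+ r) :+ ((h :+ h) :+ u) := u :- (:- h :- r)) refl (half A) r (ι A k) ⟩
    ι A k - (- half A - r)                        ∎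

corollary2p1 : ∀ {c ℓ : Level} (A : QAlgebra c ℓ) (r : QAlgebra.Carrier A) (n : ℕ) → 1 ℕ.≤ n →
    let open QAlgebra A hiding (_×_) in
      (∀ (m : ℕ) → n ≡ 2 ℕ.* m ℕ.+ 1 → d A n r (- half A) ≈ 0#)
    × (∀ (m : ℕ) → n ≡ 2 ℕ.* m → d A n r (- half A) ≈ (- 1#) ^ m * binom A (- half A - r) m)
corollary2p1 A r n _ = odd-case , even-case
  where
  open QAlgebra A hiding (_×_)
  open Antidiagonal semiring using (sum-convolution≈antidiagonal)

  b : Carrier
  b = - half A - r

  p signed-binom : ℕ → Carrier
  p k            = binom A (- half A + r + ι A k) k
  signed-binom m = (- 1#) ^ m * binom A b m

  p-step : ∀ k → ι A (suc k) * p (suc k) ≈ (ι A k - b) * p k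
  p-step k = trans (binom-diagonal-step A _ k) (*-congʳ ([−½+r]+[1+k]≈k-[−½-r] A r k))

  open Convolution.FirstOrder commRing b p (binom A b) (*-identityˡ 1#) (*-identityˡ 1#) p-step (binom-step A b)
  open TwoStepRecurrence A (λ i → ι A i - (b + b)) convolution convolution-step

  odd-case : ∀ m → n ≡ 2 ℕ.* m ℕ.+ 1 → d A n r (- half A) ≈ 0#
  odd-case m ≡.refl = trans (sum-convolution≈antidiagonal n p (binom A b)) (vanishes-at-odd convolution-1 m)

  even-case : ∀ m → n ≡ 2 ℕ.* m → d A n r (- half A) ≈ signed-binom m
  even-case m ≡.refl = trans (sum-convolution≈antidiagonal n p (binom A b))
    (unique-at-even signed-binom convolution-0≈signed-binom-0 (signed-binom-step A b) m)
    where
    convolution-0≈signed-binom-0 : convolution 0 ≈ signed-binom 0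
    convolution-0≈signed-binom-0 = trans convolution-0 (sym (trans (*-identityˡ _) (*-identityˡ 1#)))
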